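{- Let $(X,\mathcal{R})$ be a $d$-class association scheme with intersection numbers $p_{i,j}^k$, let $\Pi$ be an equitable partition of $(X,\mathcal{R})$ with $n$ cells all of the same size $|X|/n$, and let $m\ge 2$ be an integer. For $i\in\{0,\dots,d\}$ let $M_i$ be the $n\times n$ quotient matrix of the graph $\Gamma_i$ with respect to $\Pi$. If for some fixed $i\in\{1,2,\dots,d\}$ the integer $m$ divides $p_{i,i}^k$ for all $k\in\{0,1,\dots,d\}$, then the rows of $M_i$ (with entries reduced modulo $m$) span a self-orthogonal code of length $n$ over the ring $\mathbb{Z}_m$.
   Context: An association scheme with $d$ classes is a pair $(X,\mathcal{R})$ where $X$ is a finite set and $\mathcal{R}=\{R_0,\dots,R_d\}$ is a partition of $X\times X$ such that $R_0=\{(x,x):x\in X\}$, each $R_i$ is symmetric, and there are numbers $p_{i,j}^k$ such that for every $(x,y)\in R_k$ the number of $z\in X$ with $(x,z)\in R_i$ and $(z,y)\in R_j$ equals $p_{i,j}^k$. $\Gamma_i$ is the graph on $X$ whose adjacency matrix $A_i$ has $[A_i]_{xy}=1$ iff $(x,y)\in R_i$. A partition of the vertex set into cells $C_0,\dots,C_{n-1}$ is equitable for a graph if every vertex in $C_a$ has the same number $b_{a,b}$ of neighbours in $C_b$; $(b_{a,b})$ is the quotient matrix. An equitable partition of $(X,\mathcal{R})$ is one that is equitable for every $\Gamma_i$. A code over $\mathbb{Z}_m$ of length $n$ is a $\mathbb{Z}_m$-submodule $C$ of $\mathbb{Z}_m^n$; it is self-orthogonal if $\sum_l x_ly_l=0$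 in $\mathbb{Z}_m$ for all $x,y\in C$. -}

module Defs where

open import Data.Nat using (ℕ; zero; suc; _+_; _*_; _%_; _≥_; NonZero)
open import Data.Fin using (Fin; zero; suc)
open import Data.Product using (Σ; ∃; _×_; _,_)
open import Relation.Binary.PropositionalEquality using (_≡_)
open import Relation.Nullary using (Dec; yes; no)
open import Data.Fin.Properties using (_≟_)

∑ : (n : ℕ) → (Fin n → ℕ) → ℕ
∑ zero    f = 0
∑ (suc n) f = f zero + ∑ n (λ k → f (suc k))

⌊_⌋ : {P : Set} → Dec P → ℕ
⌊ yes _ ⌋ = 1
⌊ no  _ ⌋ = 0

-- An association scheme with d classes on X = Fin N.
-- R x y is the index i ∈ {0..d} of the relation R_i containing (x,y).
record AssocScheme (N d : ℕ) : Set where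
  field
    R         : Fin N → Fin N → Fin (suc d)
    diagonal  : ∀ x y → (R x y ≡ zero → x ≡ y) × (x ≡ y → R x y ≡ zero)
    symmetric : ∀ x y → R x y ≡ R y x
    nonempty  : ∀ (i : Fin (suc d)) → Σ (Fin N) λ x → Σ (Fin N) λ y → R x y ≡ i
    p         : Fin (suc d) → Fin (suc d) → Fin (suc d) → ℕ
    intersection : ∀ i j k x y → R x y ≡ k →
      ∑ N (λ z → ⌊ R x z ≟ i ⌋ * ⌊ R z y ≟ j ⌋) ≡ p i j k

nbrsIn : ∀ {N d n} → AssocScheme N d → (Fin N → Fin n) → Fin (suc d) → Fin N → Fin n → ℕ
nbrsIn {N} S cell i x b = ∑ N (λ z → ⌊ AssocScheme.R S x z ≟ i ⌋ * ⌊ cell z ≟ b ⌋)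

-- Π (given as a cell map) is an equitable partition of the scheme with
-- quotient matrices M i : Fin n → Fin n → ℕ (M i is the quotient matrix of Γ_i).
IsEquitable : ∀ {N d n} → AssocScheme N d → (Fin N → Fin n) →
              (Fin (suc d) → Fin n → Fin n → ℕ) → Set
IsEquitable S cell M = ∀ i x b → nbrsIn S cell i x b ≡ M i (cell x) b

cellSize : ∀ {N n} → (Fin N → Fin n) → Fin n → ℕ
cellSize {N} cell a = ∑ N (λ z → ⌊ cell z ≟ a ⌋)

-- Codes over ℤ_m represented by ℕ-vectors, compared modulo m.
-- x lies in the ℤ_m-span of the rows of the matrix A (entries reduced mod m).
InRowSpan : (m n : ℕ) → .{{NonZero m}} → (Fin n → Fin n → ℕ) → (Fin n → ℕ) → Set
InRowSpan m n A x = Σ (Fin n → ℕ) λ c → ∀ l → x l % m ≡ ∑ n (λ r → c r * A r l) % m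

RowSpanSelfOrthogonal : (m n : ℕ) → .{{NonZero m}} → (Fin n → Fin n → ℕ) → Set
RowSpanSelfOrthogonal m n A = ∀ x y → InRowSpan m n A x → InRowSpan m n A y →
  ∑ n (λ l → x l * y l) % m ≡ 0

-- Cells of equal size make the quotient matrix M = M_i symmetric: both s·M_ab and s·M_ba count
-- the Γ_i-edges between cells a and b. Reading the entry (M²)_ab from a vertex x of cell a, the
-- walks x – z – w of type (i, i) with w in cell b are counted by Σ_w p_ii^{R(x,w)} [w ∈ b], so m
-- divides every entry of M² = M Mᵀ. Hence any two rows of M are orthogonal modulo m, and by
-- bilinearity so are any two combinations of rows.
module Submission where

open import Defs
open import Data.Nat using (ℕ; zero; suc; _+_; _*_; _%_; _≥_; z≤n; s≤s; NonZero; >-nonZero)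
open import Data.Nat.Properties
  using (*-comm; *-assoc; *-identityˡ; +-identityʳ; *-cancelˡ-≡; *-commutativeSemigroup; +-*-semiring)
open import Algebra.Properties.CommutativeSemigroup *-commutativeSemigroup using (x∙yz≈z∙yx)
import Algebra.Properties.Semiring.Sum +-*-semiring as Sum
open import Data.Nat.DivMod using (%-distribˡ-+; %-distribˡ-*)
open import Data.Nat.Divisibility using (_∣_; _∣0; ∣m∣n⇒∣m+n; ∣m⇒∣m*n; ∣n⇒∣m*n; n∣m⇒m%n≡0)
open import Data.Fin using (Fin; zero)
import Data.Fin as F
open import Data.Fin.Properties using (_≟_; suc-injective)
open import Data.Product using (∃; _,_)
open import Function using (_∘_)
open import Relation.Binary.PropositionalEquality
  using (_≡_; _≢_; refl; sym; trans; cong; cong₂; subst; _≗_; module ≡-Reasoning)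
open import Relation.Nullary using (Dec; yes; no; ¬_)
open import Data.Empty using (⊥-elim)

open ≡-Reasoning

⌊⌋-yes : ∀ {P : Set} (p? : Dec P) → P → ⌊ p? ⌋ ≡ 1
⌊⌋-yes (yes _) _ = refl
⌊⌋-yes (no ¬p) p = ⊥-elim (¬p p)

⌊⌋-no : ∀ {P : Set} (p? : Dec P) → ¬ P → ⌊ p? ⌋ ≡ 0
⌊⌋-no (yes p) ¬p = ⊥-elim (¬p p)
⌊⌋-no (no _)  _  = refl

⌊⌋≥1⇒ : ∀ {P : Set} (p? : Dec P) → ⌊ p? ⌋ ≥ 1 → P
⌊⌋≥1⇒ (yes p) _ = p

∑≡sum : ∀ n (f : Fin n → ℕ) → ∑ n f ≡ Sum.sum f
∑≡sum zero    f = refl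
∑≡sum (suc n) f = cong (f zero +_) (∑≡sum n (f ∘ F.suc))

∑-cong : ∀ n {f g : Fin n → ℕ} → f ≗ g → ∑ n f ≡ ∑ n g
∑-cong n {f} {g} f≗g = trans (∑≡sum n f) (trans (Sum.sum-cong-≗ f≗g) (sym (∑≡sum n g)))

∑-distribˡ : ∀ n c (f : Fin n → ℕ) → c * ∑ n f ≡ ∑ n (λ k → c * f k)
∑-distribˡ n c f = begin
  c * ∑ n f                ≡⟨ cong (c *_) (∑≡sum n f) ⟩
  c * Sum.sum f            ≡⟨ Sum.*-distribˡ-sum c f ⟩
  Sum.sum (λ k → c * f k)  ≡⟨ sym (∑≡sum n _) ⟩
  ∑ n (λ k → c * f k)      ∎

∑-distribʳ : ∀ n c (f : Fin n → ℕ) → ∑ n f * c ≡ ∑ n (λ k → f k * c)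
∑-distribʳ n c f = begin
  ∑ n f * c                ≡⟨ cong (_* c) (∑≡sum n f) ⟩
  Sum.sum f * c            ≡⟨ Sum.*-distribʳ-sum c f ⟩
  Sum.sum (λ k → f k * c)  ≡⟨ sym (∑≡sum n _) ⟩
  ∑ n (λ k → f k * c)      ∎

∑-comm : ∀ p q (f : Fin p → Fin q → ℕ) →
         ∑ p (λ a → ∑ q (f a)) ≡ ∑ q (λ b → ∑ p (λ a → f a b))
∑-comm p q f = begin
  ∑ p (λ a → ∑ q (f a))
    ≡⟨ trans (∑-cong p (λ a → ∑≡sum q (f a))) (∑≡sum p _) ⟩
  Sum.sum (λ a → Sum.sum (f a))
    ≡⟨ Sum.∑-comm f ⟩
  Sum.sum (λ b → Sum.sum (λ a → f a b))
    ≡⟨ sym (trans (∑-cong q (λ b → ∑≡sum p _)) (∑≡sum q _)) ⟩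
  ∑ q (λ b → ∑ p (λ a → f a b))
    ∎

∑-reassoc : ∀ p q (u : Fin q → ℕ) (V : Fin q → Fin p → ℕ) (g : Fin p → ℕ) →
            ∑ p (λ c → ∑ q (λ z → u z * V z c) * g c) ≡ ∑ q (λ z → u z * ∑ p (λ c → V z c * g c))
∑-reassoc p q u V g = begin
  ∑ p (λ c → ∑ q (λ z → u z * V z c) * g c)
    ≡⟨ ∑-cong p (λ c → ∑-distribʳ q (g c) _) ⟩
  ∑ p (λ c → ∑ q (λ z → u z * V z c * g c))
    ≡⟨ ∑-comm p q _ ⟩
  ∑ q (λ z → ∑ p (λ c → u z * V z c * g c))
    ≡⟨ ∑-cong q (λ z → ∑-cong p (λ c → *-assoc (u z) _ _)) ⟩
  ∑ q (λ z → ∑ p (λ c → u z * (V z c * g c)))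
    ≡⟨ ∑-cong q (λ z → sym (∑-distribˡ p (u z) _)) ⟩
  ∑ q (λ z → u z * ∑ p (λ c → V z c * g c))
    ∎

∑-single : ∀ n (a : Fin n) (f : Fin n → ℕ) → (∀ k → k ≢ a → f k ≡ 0) → ∑ n f ≡ f a
∑-single (suc n) zero f vanish = begin
  f zero + ∑ n (f ∘ F.suc)  ≡⟨ cong (f zero +_) (∑-cong n (λ k → vanish (F.suc k) λ ())) ⟩
  f zero + ∑ n (λ _ → 0)    ≡⟨ cong (f zero +_) (trans (∑≡sum n _) (Sum.sum-replicate-zero n)) ⟩
  f zero + 0                ≡⟨ +-identityʳ (f zero) ⟩
  f zero                    ∎
∑-single (suc n) (F.suc a) f vanish =
  cong₂ _+_ (vanish zero λ ())
            (∑-single n a (f ∘ F.suc) (λ k k≢a → vanish (F.suc k) (k≢a ∘ suc-injective)))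

∑≥1⇒∃≥1 : ∀ n (f : Fin n → ℕ) → ∑ n f ≥ 1 → ∃ λ k → f k ≥ 1
∑≥1⇒∃≥1 (suc n) f ∑≥1 with f zero in f0≡
... | suc _ = zero , subst (_≥ 1) (sym f0≡) (s≤s z≤n)
... | zero with ∑≥1⇒∃≥1 n (f ∘ F.suc) ∑≥1
...   | k , fk≥1 = F.suc k , fk≥1

∣-∑ : ∀ {m} n (f : Fin n → ℕ) → (∀ k → m ∣ f k) → m ∣ ∑ n f
∣-∑ zero    f m∣f = _ ∣0
∣-∑ (suc n) f m∣f = ∣m∣n⇒∣m+n (m∣f zero) (∣-∑ n (f ∘ F.suc) (m∣f ∘ F.suc))

∑-cong-% : ∀ m .{{_ : NonZero m}} n (f g : Fin n → ℕ) →
           (∀ k → f k % m ≡ g k % m) → ∑ n f % m ≡ ∑ n g % m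
∑-cong-% m zero    f g f≡g = refl
∑-cong-% m (suc n) f g f≡g = begin
  (f zero + ∑ n (f ∘ F.suc)) % m              ≡⟨ %-distribˡ-+ (f zero) _ m ⟩
  (f zero % m + ∑ n (f ∘ F.suc) % m) % m      ≡⟨ cong₂ (λ a b → (a + b) % m) (f≡g zero)
                                                    (∑-cong-% m n _ _ (f≡g ∘ F.suc)) ⟩
  (g zero % m + ∑ n (g ∘ F.suc) % m) % m      ≡⟨ sym (%-distribˡ-+ (g zero) _ m) ⟩
  (g zero + ∑ n (g ∘ F.suc)) % m              ∎

*-cong-% : ∀ m .{{_ : NonZero m}} {a b a′ b′} → a % m ≡ a′ % m → b % m ≡ b′ % m →
           (a * b) % m ≡ (a′ * b′) % m
*-cong-% m {a} {b} {a′} {b′} a≡a′ b≡b′ = begin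
  (a * b) % m                ≡⟨ %-distribˡ-* a b m ⟩
  ((a % m) * (b % m)) % m    ≡⟨ cong₂ (λ x y → (x * y) % m) a≡a′ b≡b′ ⟩
  ((a′ % m) * (b′ % m)) % m  ≡⟨ sym (%-distribˡ-* a′ b′ m) ⟩
  (a′ * b′) % m              ∎

_·_ : ∀ {n} → (Fin n → ℕ) → (Fin n → ℕ) → ℕ
_·_ {n} u v = ∑ n (λ l → u l * v l)

·-comm : ∀ {n} (u v : Fin n → ℕ) → u · v ≡ v · u
·-comm {n} u v = ∑-cong n (λ l → *-comm (u l) (v l))

∣-combination-· : ∀ {m n} (c : Fin n → ℕ) (A : Fin n → Fin n → ℕ) (v : Fin n → ℕ) →
                  (∀ r → m ∣ A r · v) → m ∣ (λ l → ∑ n (λ r → c r * A r l)) · v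
∣-combination-· {m} {n} c A v m∣A·v =
  subst (m ∣_) (sym (∑-reassoc n n c A v)) (∣-∑ n _ (λ r → ∣n⇒∣m*n (c r) (m∣A·v r)))

rowSpan-selfOrthogonal : ∀ m .{{_ : NonZero m}} n (A : Fin n → Fin n → ℕ) →
                         (∀ a b → m ∣ A a · A b) → RowSpanSelfOrthogonal m n A
rowSpan-selfOrthogonal m n A rows⊥ x y (cx , x≡X) (cy , y≡Y) = begin
  (x · y) % m  ≡⟨ ∑-cong-% m n _ _ (λ l → *-cong-% m (x≡X l) (y≡Y l)) ⟩
  (X · Y) % m  ≡⟨ n∣m⇒m%n≡0 _ m (∣-combination-· cx A Y A·Y) ⟩
  0            ∎
  where
  X Y : Fin n → ℕ
  X l = ∑ n (λ r → cx r * A r l)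
  Y l = ∑ n (λ r → cy r * A r l)
  A·Y : ∀ r → m ∣ A r · Y
  A·Y r = subst (m ∣_) (·-comm Y (A r)) (∣-combination-· cy A (A r) (λ r′ → rows⊥ r′ r))

module _ {N d n} (S : AssocScheme N d) (cell : Fin N → Fin n) where
  open AssocScheme S

  adj : Fin (suc d) → Fin N → Fin N → ℕ
  adj i x z = ⌊ R x z ≟ i ⌋

  inCell : Fin N → Fin n → ℕ
  inCell z b = ⌊ cell z ≟ b ⌋

  cell-inhabited : ∀ a → cellSize cell a ≥ 1 → ∃ λ x → cell x ≡ a
  cell-inhabited a size≥1 with ∑≥1⇒∃≥1 N (λ z → inCell z a) size≥1
  ... | x , x∈a = x , ⌊⌋≥1⇒ (cell x ≟ a) x∈a

  ∑-inCell : ∀ z (g : Fin n → ℕ) → ∑ n (λ c → inCell z c * g c) ≡ g (cell z)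
  ∑-inCell z g = begin
    ∑ n (λ c → inCell z c * g c)  ≡⟨ ∑-single n (cell z) _ (λ c c≢ → cong (_* g c)
                                        (⌊⌋-no (cell z ≟ c) (c≢ ∘ sym))) ⟩
    inCell z (cell z) * g (cell z)  ≡⟨ cong (_* g (cell z)) (⌊⌋-yes (cell z ≟ cell z) refl) ⟩
    1 * g (cell z)                  ≡⟨ *-identityˡ _ ⟩
    g (cell z)                      ∎

  edgesBetween : Fin (suc d) → Fin n → Fin n → ℕ
  edgesBetween i a b = ∑ N (λ x → ∑ N (λ z → inCell x a * (adj i x z * inCell z b)))

  edgesBetween-comm : ∀ i a b → edgesBetween i a b ≡ edgesBetween i b a
  edgesBetween-comm i a b = trans (∑-comm N N _) (∑-cong N (λ z → ∑-cong N (λ x → swap z x)))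
    where
    swap : ∀ z x → inCell x a * (adj i x z * inCell z b) ≡ inCell z b * (adj i z x * inCell x a)
    swap z x rewrite symmetric x z = x∙yz≈z∙yx (inCell x a) (adj i z x) (inCell z b)

  module _ (M : Fin (suc d) → Fin n → Fin n → ℕ) (equitable : IsEquitable S cell M) where

    cellSize-*-quotient : ∀ i a b → cellSize cell a * M i a b ≡ edgesBetween i a b
    cellSize-*-quotient i a b = begin
      cellSize cell a * M i a b                      ≡⟨ ∑-distribʳ N (M i a b) _ ⟩
      ∑ N (λ x → inCell x a * M i a b)               ≡⟨ ∑-cong N onCell ⟩
      ∑ N (λ x → inCell x a * nbrsIn S cell i x b)   ≡⟨ ∑-cong N (λ x → ∑-distribˡ N (inCell x a) _) ⟩
      edgesBetween i a b                             ∎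
      where
      onCell : ∀ x → inCell x a * M i a b ≡ inCell x a * nbrsIn S cell i x b
      onCell x with cell x ≟ a
      ... | yes x∈a = cong (1 *_) (sym (trans (equitable i x b) (cong (λ t → M i t b) x∈a)))
      ... | no _    = refl

    quotient-symmetric : ∀ {s} → (∀ a → cellSize cell a ≡ s) → s ≥ 1 →
                         ∀ i a b → M i a b ≡ M i b a
    quotient-symmetric {s} size s≥1 i a b =
      *-cancelˡ-≡ (M i a b) (M i b a) s {{>-nonZero s≥1}} (begin
        s * M i a b                ≡⟨ cong (_* M i a b) (sym (size a)) ⟩
        cellSize cell a * M i a b  ≡⟨ cellSize-*-quotient i a b ⟩
        edgesBetween i a b         ≡⟨ edgesBetween-comm i a b ⟩
        edgesBetween i b a         ≡⟨ sym (cellSize-*-quotient i b a) ⟩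
        cellSize cell b * M i b a  ≡⟨ cong (_* M i b a) (size b) ⟩
        s * M i b a                ∎)

    ∑-quotient-row : ∀ i x (g : Fin n → ℕ) →
                     ∑ n (λ c → M i (cell x) c * g c) ≡ ∑ N (λ z → adj i x z * g (cell z))
    ∑-quotient-row i x g = begin
      ∑ n (λ c → M i (cell x) c * g c)
        ≡⟨ ∑-cong n (λ c → cong (_* g c) (sym (equitable i x c))) ⟩
      ∑ n (λ c → nbrsIn S cell i x c * g c)
        ≡⟨ ∑-reassoc n N (adj i x) inCell g ⟩
      ∑ N (λ z → adj i x z * ∑ n (λ c → inCell z c * g c))
        ≡⟨ ∑-cong N (λ z → cong (adj i x z *_) (∑-inCell z g)) ⟩
      ∑ N (λ z → adj i x z * g (cell z))
        ∎

    quotient-square : ∀ i j x b →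
                      ∑ n (λ c → M i (cell x) c * M j c b) ≡ ∑ N (λ w → p i j (R x w) * inCell w b)
    quotient-square i j x b = begin
      ∑ n (λ c → M i (cell x) c * M j c b)
        ≡⟨ ∑-quotient-row i x (λ c → M j c b) ⟩
      ∑ N (λ z → adj i x z * M j (cell z) b)
        ≡⟨ ∑-cong N (λ z → cong (adj i x z *_) (sym (equitable j z b))) ⟩
      ∑ N (λ z → adj i x z * nbrsIn S cell j z b)
        ≡⟨ sym (∑-reassoc N N (adj i x) (adj j) (λ w → inCell w b)) ⟩
      ∑ N (λ w → ∑ N (λ z → adj i x z * adj j z w) * inCell w b)
        ≡⟨ ∑-cong N (λ w → cong (_* inCell w b) (intersection i j (R x w) x w refl)) ⟩
      ∑ N (λ w → p i j (R x w) * inCell w b)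
        ∎

    ∣-quotient-square : ∀ {m} i j → (∀ k → m ∣ p i j k) → (∀ a → cellSize cell a ≥ 1) →
                        ∀ a b → m ∣ ∑ n (λ c → M i a c * M j c b)
    ∣-quotient-square {m} i j m∣p inhabited a b with cell-inhabited a (inhabited a)
    ... | x , refl = subst (m ∣_) (sym (quotient-square i j x b))
                       (∣-∑ N _ (λ w → ∣m⇒∣m*n (inCell w b) (m∣p (R x w))))

theorem3p3 : ∀ {N d n : ℕ} (S : AssocScheme N d) (cell : Fin N → Fin n)
    (M : Fin (suc d) → Fin n → Fin n → ℕ) (s : ℕ) (m : ℕ) .{{_ : NonZero m}} →
    IsEquitable S cell M →
    (∀ a → cellSize cell a ≡ s) → s ≥ 1 →
    m ≥ 2 →
    (i : Fin (suc d)) → i ≢ zero →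
    (∀ k → m ∣ AssocScheme.p S i i k) →
    RowSpanSelfOrthogonal m n (M i)
theorem3p3 {n = n} S cell M s m equitable size s≥1 _ i _ m∣p =
  rowSpan-selfOrthogonal m n (M i) rows⊥
  where
  rows⊥ : ∀ a b → m ∣ M i a · M i b
  rows⊥ a b = subst (m ∣_)
    (∑-cong n (λ c → cong (M i a c *_) (quotient-symmetric S cell M equitable size s≥1 i c b)))
    (∣-quotient-square S cell M equitable i i m∣p (λ a → subst (_≥ 1) (sym (size a)) s≥1) a b)
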